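{- Let $d(t)=\sum_{i\ge0}d_it^i$ with $d_0\neq0$, let $m\ge0$, and suppose the matrix $\mathrm{Der}^{2m}(\mathcal{R}(d(t),t))$ maps the sequence $(a_n)_{n\ge0}$ to the sequence $(b_n)_{n\ge0}$ (i.e. $b_n=\sum_k M_{n,k}a_k$ where $M=\mathrm{Der}^{2m}(\mathcal{R}(d(t),t))$). Then $$b_n=\sum_{k\ge0}a_k\,d_{n-k}\,(n-k+1)^m,$$ with $d_j=0$ for $j<0$.
   Context: For formal power series $d(t),h(t)$ with $d(0)\neq0$, $h(0)=0$, $h'(0)\neq0$, $\mathcal{R}(d(t),h(t))$ is the infinite lower triangular matrix with $(n,k)$-entry $[t^n]\,d(t)h(t)^k$ ($n,k\ge0$). $\mathrm{Der}(\mathcal{R}(d(t),h(t)))=\mathcal{R}(h'(t),t\,d(t))$, and $\mathrm{Der}^k$ is $\mathrm{Der}$ iterated $k$ times. -}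

module Defs where

open import Level using (Level)
open import Data.Nat using (ℕ; zero; suc; _∸_; _^_) renaming (_+_ to _+ℕ_; _*_ to _*ℕ_)
open import Data.Product using (_×_; _,_; proj₁; proj₂)
open import Algebra.Bundles using (CommutativeRing)

module _ {c ℓ : Level} (R : CommutativeRing c ℓ) where
  open CommutativeRing R

  PowerSeries : Set c
  PowerSeries = ℕ → Carrier

  _·_ : ℕ → Carrier → Carrier
  zero  · x = 0#
  suc n · x = x + (n · x)

  sumTo : ℕ → (ℕ → Carrier) → Carrier
  sumTo zero    f = f 0
  sumTo (suc n) f = sumTo n f + f (suc n)

  one : PowerSeries
  one zero    = 1#
  one (suc _) = 0#

  X : PowerSeries
  X zero          = 0#
  X (suc zero)    = 1#
  X (suc (suc _)) = 0#

  _⊛_ : PowerSeries → PowerSeries → PowerSeries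
  (f ⊛ g) n = sumTo n (λ i → f i * g (n ∸ i))

  pow : PowerSeries → ℕ → PowerSeries
  pow f zero    = one
  pow f (suc k) = f ⊛ pow f k

  deriv : PowerSeries → PowerSeries
  deriv f n = suc n · f (suc n)

  RPair : Set c
  RPair = PowerSeries × PowerSeries

  riordan : RPair → ℕ → ℕ → Carrier
  riordan (d , h) n k = (d ⊛ pow h k) n

  Der : RPair → RPair
  Der (d , h) = (deriv h , X ⊛ d)

  Der^ : ℕ → RPair → RPair
  Der^ zero    p = p
  Der^ (suc k) p = Der (Der^ k p)

  -- action of a lower-triangular matrix M on a sequence a:
  -- (M a)_n = Σ_k M_{n,k} a_k = Σ_{k ≤ n} M_{n,k} a_k
  -- (all matrices here are lower triangular, as h(0) = 0 is preserved by Der)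
  applyLT : (ℕ → ℕ → Carrier) → (ℕ → Carrier) → ℕ → Carrier
  applyLT M a n = sumTo n (λ k → M n k * a k)

-- Der² sends R(d, t) to R((t d)', t): since t' = 1 the second component stays t,
-- and (t d)' has coefficients (n+1) dₙ.  Hence Der^{2m} R(d, t) = R(e, t) with
-- eₙ = (n+1)^m dₙ, and R(e, t) is the Toeplitz matrix with entries e_{n-k}
-- because tᵏ picks out the single coefficient of index n - k in the product.
module Submission where

open import Defs
open import Level using (Level)
open import Data.Nat using (ℕ; zero; suc; _∸_; _^_; _≤_; _≟_; z≤n; s≤s)
import Data.Nat as ℕ
open import Algebra.Bundles using (CommutativeRing)
open import Data.Nat.Properties
  using (≤-refl; m≤n⇒m≤1+n; ≤-pred; ≤∧≢⇒<; <⇒≢; m∸n≤m; m∸[m∸n]≡n; *-suc)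
open import Data.Product using (_×_; _,_; proj₁; proj₂)
open import Relation.Binary.PropositionalEquality using (_≡_; _≢_)
import Relation.Binary.PropositionalEquality as ≡
open import Relation.Nullary using (¬_; yes; no)
open import Data.Empty using (⊥-elim)
import Algebra.Properties.Monoid.Mult as MonoidMult
import Relation.Binary.Reasoning.Setoid as SetoidReasoning

module RiordanLemmas {c ℓ : Level} (R : CommutativeRing c ℓ) where
  open CommutativeRing R hiding (zero)
  open MonoidMult +-monoid using (×-congʳ; ×-assocˡ) renaming (_×_ to _×ₘ_)
  open SetoidReasoning setoid

  infix 4 _≗_
  _≗_ : PowerSeries R → PowerSeries R → Set ℓ
  f ≗ g = ∀ n → f n ≈ g n

  ·≡× : ∀ n x → _·_ R n x ≡ n ×ₘ x
  ·≡× zero    x = ≡.refl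
  ·≡× (suc n) x = ≡.cong (x +_) (·≡× n x)

  ·-congʳ : ∀ n {x y} → x ≈ y → _·_ R n x ≈ _·_ R n y
  ·-congʳ n {x} {y} x≈y rewrite ·≡× n x | ·≡× n y = ×-congʳ n x≈y

  ·-assoc : ∀ m n x → _·_ R m (_·_ R n x) ≈ _·_ R (m ℕ.* n) x
  ·-assoc m n x rewrite ·≡× n x | ·≡× m (n ×ₘ x) | ·≡× (m ℕ.* n) x = ×-assocˡ x m n

  ·-zeroʳ : ∀ n → _·_ R n 0# ≈ 0#
  ·-zeroʳ zero    = refl
  ·-zeroʳ (suc n) = trans (+-identityˡ _) (·-zeroʳ n)

  sumTo-cong : ∀ n {f g : ℕ → Carrier} → (∀ i → i ≤ n → f i ≈ g i) → sumTo R n f ≈ sumTo R n g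
  sumTo-cong zero    f≈g = f≈g 0 z≤n
  sumTo-cong (suc n) f≈g = +-cong (sumTo-cong n (λ i i≤n → f≈g i (m≤n⇒m≤1+n i≤n))) (f≈g (suc n) ≤-refl)

  sumTo-zero : ∀ n (g : ℕ → Carrier) → (∀ i → i ≤ n → g i ≈ 0#) → sumTo R n g ≈ 0#
  sumTo-zero zero    g g≈0 = g≈0 0 z≤n
  sumTo-zero (suc n) g g≈0 = begin
    sumTo R n g + g (suc n) ≈⟨ +-cong (sumTo-zero n g (λ i i≤n → g≈0 i (m≤n⇒m≤1+n i≤n))) (g≈0 (suc n) ≤-refl) ⟩
    0# + 0#                 ≈⟨ +-identityˡ 0# ⟩
    0#                      ∎

  sumTo-single : ∀ n j (g : ℕ → Carrier) → j ≤ n → (∀ i → i ≤ n → i ≢ j → g i ≈ 0#) →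
                 sumTo R n g ≈ g j
  sumTo-single zero    zero g _ _ = refl
  sumTo-single (suc n) j g j≤1+n g≈0 with j ≟ suc n
  ... | yes ≡.refl = begin
    sumTo R n g + g (suc n) ≈⟨ +-congʳ (sumTo-zero n g (λ i i≤n → g≈0 i (m≤n⇒m≤1+n i≤n) (<⇒≢ (s≤s i≤n)))) ⟩
    0# + g (suc n)          ≈⟨ +-identityˡ _ ⟩
    g (suc n)               ∎
  ... | no j≢1+n = begin
    sumTo R n g + g (suc n) ≈⟨ +-cong (sumTo-single n j g (≤-pred (≤∧≢⇒< j≤1+n j≢1+n))
                                         (λ i i≤n → g≈0 i (m≤n⇒m≤1+n i≤n)))
                                      (g≈0 (suc n) ≤-refl (λ 1+n≡j → j≢1+n (≡.sym 1+n≡j))) ⟩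
    g j + 0#                ≈⟨ +-identityʳ _ ⟩
    g j                     ∎

  ⊛-cong : ∀ {f f′ g g′} → f ≗ f′ → g ≗ g′ → _⊛_ R f g ≗ _⊛_ R f′ g′
  ⊛-cong f≗f′ g≗g′ n = sumTo-cong n (λ i _ → *-cong (f≗f′ i) (g≗g′ (n ∸ i)))

  pow-cong : ∀ {f g} → f ≗ g → ∀ k → pow R f k ≗ pow R g k
  pow-cong f≗g zero    = λ _ → refl
  pow-cong f≗g (suc k) = ⊛-cong f≗g (pow-cong f≗g k)

  X⊛-zero : ∀ f → _⊛_ R (X R) f 0 ≈ 0#
  X⊛-zero f = zeroˡ _

  sumTo-X* : ∀ n (g : ℕ → Carrier) → sumTo R (suc n) (λ i → X R i * g i) ≈ g 1
  sumTo-X* zero    g = trans (+-cong (zeroˡ _) (*-identityˡ _)) (+-identityˡ _)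
  sumTo-X* (suc n) g = trans (+-cong (sumTo-X* n g) (zeroˡ _)) (+-identityʳ _)

  X⊛-suc : ∀ f n → _⊛_ R (X R) f (suc n) ≈ f n
  X⊛-suc f n = sumTo-X* n (λ i → f (suc n ∸ i))

  pow-X-diagonal : ∀ k → pow R (X R) k k ≈ 1#
  pow-X-diagonal zero    = refl
  pow-X-diagonal (suc k) = trans (X⊛-suc (pow R (X R) k) k) (pow-X-diagonal k)

  pow-X-offDiagonal : ∀ k j → j ≢ k → pow R (X R) k j ≈ 0#
  pow-X-offDiagonal zero    zero    j≢k = ⊥-elim (j≢k ≡.refl)
  pow-X-offDiagonal zero    (suc j) j≢k = refl
  pow-X-offDiagonal (suc k) zero    j≢k = X⊛-zero (pow R (X R) k)
  pow-X-offDiagonal (suc k) (suc j) j≢k =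
    trans (X⊛-suc (pow R (X R) k) j) (pow-X-offDiagonal k j (λ j≡k → j≢k (≡.cong suc j≡k)))

  ⊛-pow-X : ∀ f k n → k ≤ n → _⊛_ R f (pow R (X R) k) n ≈ f (n ∸ k)
  ⊛-pow-X f k n k≤n = begin
    sumTo R n term                         ≈⟨ sumTo-single n (n ∸ k) term (m∸n≤m n k) off ⟩
    f (n ∸ k) * pow R (X R) k (n ∸ (n ∸ k)) ≈⟨ *-congˡ (≡.subst (λ j → pow R (X R) k j ≈ 1#)
                                                     (≡.sym (m∸[m∸n]≡n k≤n)) (pow-X-diagonal k)) ⟩
    f (n ∸ k) * 1#                         ≈⟨ *-identityʳ _ ⟩
    f (n ∸ k)                              ∎
    where
    term : ℕ → Carrier
    term i = f i * pow R (X R) k (n ∸ i)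
    off : ∀ i → i ≤ n → i ≢ n ∸ k → term i ≈ 0#
    off i i≤n i≢n∸k = trans (*-congˡ (pow-X-offDiagonal k (n ∸ i) n∸i≢k)) (zeroʳ _)
      where
      n∸i≢k : n ∸ i ≢ k
      n∸i≢k n∸i≡k = i≢n∸k (≡.trans (≡.sym (m∸[m∸n]≡n i≤n)) (≡.cong (n ∸_) n∸i≡k))

  riordan-t : ∀ p → proj₂ p ≗ X R → ∀ n k → k ≤ n → riordan R p n k ≈ proj₁ p (n ∸ k)
  riordan-t (e , h) h≗X n k k≤n =
    trans (⊛-cong (λ _ → refl) (pow-cong h≗X k) n) (⊛-pow-X e k n k≤n)

  deriv-X⊛ : ∀ f n → deriv R (_⊛_ R (X R) f) n ≈ _·_ R (suc n) (f n)
  deriv-X⊛ f n = ·-congʳ (suc n) (X⊛-suc f n)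

  X⊛deriv-X : ∀ h → h ≗ X R → _⊛_ R (X R) (deriv R h) ≗ X R
  X⊛deriv-X h h≗X zero          = X⊛-zero (deriv R h)
  X⊛deriv-X h h≗X (suc zero)    = trans (X⊛-suc (deriv R h) 0) (trans (·-congʳ 1 (h≗X 1)) (+-identityʳ _))
  X⊛deriv-X h h≗X (suc (suc n)) =
    trans (X⊛-suc (deriv R h) (suc n)) (trans (·-congʳ (suc (suc n)) (h≗X (suc (suc n)))) (·-zeroʳ (suc (suc n))))

  scaled : ℕ → PowerSeries R → PowerSeries R
  scaled m d n = _·_ R (suc n ^ m) (d n)

  Der^-2*-suc : ∀ m p → Der^ R (2 ℕ.* suc m) p ≡ Der R (Der R (Der^ R (2 ℕ.* m) p))
  Der^-2*-suc m p = ≡.cong (λ j → Der^ R j p) (*-suc 2 m)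

  infix 4 _≋_
  _≋_ : RPair R → RPair R → Set ℓ
  p ≋ q = proj₁ p ≗ proj₁ q × proj₂ p ≗ proj₂ q

  Der²-t : ∀ p → proj₂ p ≗ X R → Der R (Der R p) ≋ ((λ n → _·_ R (suc n) (proj₁ p n)) , X R)
  Der²-t (e , h) h≗X = deriv-X⊛ e , X⊛deriv-X h h≗X

  Der^-even-t : ∀ d m → Der^ R (2 ℕ.* m) (d , X R) ≋ (scaled m d , X R)
  Der^-even-t d zero    = (λ _ → sym (+-identityʳ _)) , (λ _ → refl)
  Der^-even-t d (suc m) =
    ≡.subst (_≋ (scaled (suc m) d , X R)) (≡.sym (Der^-2*-suc m (d , X R))) (first , proj₂ step)
    where
    p : RPair R
    p = Der^ R (2 ℕ.* m) (d , X R)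
    ih : p ≋ (scaled m d , X R)
    ih = Der^-even-t d m
    step : Der R (Der R p) ≋ ((λ n → _·_ R (suc n) (proj₁ p n)) , X R)
    step = Der²-t p (proj₂ ih)
    first : proj₁ (Der R (Der R p)) ≗ scaled (suc m) d
    first n = begin
      proj₁ (Der R (Der R p)) n          ≈⟨ proj₁ step n ⟩
      _·_ R (suc n) (proj₁ p n)          ≈⟨ ·-congʳ (suc n) (proj₁ ih n) ⟩
      _·_ R (suc n) (scaled m d n)       ≈⟨ ·-assoc (suc n) (suc n ^ m) (d n) ⟩
      scaled (suc m) d n                 ∎

  riordan-Der^-even-t : ∀ d m n k → k ≤ n → riordan R (Der^ R (2 ℕ.* m) (d , X R)) n k ≈ scaled m d (n ∸ k)
  riordan-Der^-even-t d m n k k≤n =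
    trans (riordan-t _ (proj₂ Der^≋) n k k≤n) (proj₁ Der^≋ (n ∸ k))
    where
    Der^≋ : Der^ R (2 ℕ.* m) (d , X R) ≋ (scaled m d , X R)
    Der^≋ = Der^-even-t d m

-- Only now: inside RiordanLemmas an unqualified _*_ is the ring multiplication.
open import Data.Nat using (_*_)

-- The hypothesis d₀ ≠ 0 only makes (d, t) a Riordan pair; the identity holds without it.
corollary4p10 : {c ℓ : Level} (R : CommutativeRing c ℓ) (d : ℕ → CommutativeRing.Carrier R) →
    ¬ (CommutativeRing._≈_ R (d 0) (CommutativeRing.0# R)) →
    (m : ℕ) (a b : ℕ → CommutativeRing.Carrier R) →
    (∀ n → CommutativeRing._≈_ R (b n) (applyLT R (riordan R (Der^ R (2 * m) (d , X R))) a n)) →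
    ∀ n → CommutativeRing._≈_ R (b n)
    (sumTo R n (λ k → CommutativeRing._*_ R (a k) (_·_ R (suc (n ∸ k) ^ m) (d (n ∸ k)))))
corollary4p10 R d _ m a b b≈Ma n =
  trans (b≈Ma n) (sumTo-cong n (λ k k≤n → trans (*-congʳ (riordan-Der^-even-t d m n k k≤n)) (*-comm _ _)))
  where
  open CommutativeRing R using (trans; *-congʳ; *-comm)
  open RiordanLemmas R using (sumTo-cong; riordan-Der^-even-t)
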